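{- For $\varepsilon$ sufficiently large, the set of feasible solutions of the minimum cost integer flow problem and that of the problem (c-MMCIF) coincide, in the sense that \[\Bigl\{f+\sum_{a\notin T}\lambda_a\,\chi(C_a):\ \lambda\ \text{feasible for (c-MMCIF)}\Bigr\}\] is exactly the set of feasible integer flows.
   Context: Setting: a connected directed graph $D=(V,A)$ with lower capacities $l_{ij}=0$, finite integer upper capacities $u_{ij}$, integer balances $b_i$, and two cost vectors $c^1,c^2$; feasible flows are $f\in\mathbb{Z}^A$ with $\sum_{j:(i,j)\in A}f_{ij}-\sum_{j:(j,i)\in A}f_{ji}=b_i$ for all $i$ and $0\le f_{ij}\le u_{ij}$. A tree solution is a flow $f$ together with a spanning tree $T$ of $D$ (ignoring orientation) and a partition $A\setminus T=L\cup U$ with $f_{ij}=0$ on $L$ and $f_{ij}=u_{ij}$ on $U$. Let $f$ be a tree solution with structure $(T,L,U)$ that is optimal for cost $c^1$. For a non-tree arc $a=(i,j)$, the induced cycle $C_a$ is the unique undirected cycle formed by $a$ and the tree path from $j$ to $i$; it is oriented in the direction of $a$ if $a\in L$ and opposite to $a$ if $a\in U$. $C_a^+$ ($C_a^-$) is the set of arcs of $C_a$ directed along (against) this orientation, and $\chi(C_a)\in\{ -1,0,1\}^A$ has $\chi_{ij}(C_a)=1$ if $(i,j)\in C_a^+$, $-1$ if $(i,j)\in C_a^-$, $0$ otherwise; $c^k(C_a)=\sum_{(i,j)\in A}c^k_{ij}\chi_{ij}(C_a)$. Problem (c-MMCIF), with integer variables $\lambda_a$ for $a\in A\setminus T$: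 minimize $\sum_{a\notin T}\lambda_a c^1(C_a)$ subject to $0-f_{ij}\le\sum_{a:(i,j)\in C_a}\lambda_a\chi_{ij}(C_a)\le u_{ij}-f_{ij}$ for all $(i,j)\in\bigcup_{a\notin T}C_a$, and $\sum_{a\notin T}\lambda_a c^2(C_a)\le\varepsilon$.
   Formalization: The cost vectors $c^1,c^2$ and the threshold $\varepsilon$ take rational values. -}

module Defs where

open import Data.Nat as ℕ using (ℕ; zero; suc)
open import Data.Fin using (Fin; zero; suc; _≟_)
open import Data.Integer as ℤ using (ℤ; 0ℤ; 1ℤ)
open import Data.Rational as ℚ using (ℚ)
open import Data.Bool using (Bool; true; false; if_then_else_)
open import Data.List using (List; []; _∷_; _++_; [_])
open import Data.List.Membership.Propositional using (_∈_)
open import Data.List.Relation.Unary.Unique.Propositional using (Unique)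
open import Data.Sum using (_⊎_)
open import Data.Product using (Σ; _×_; ∃; ∃-syntax)
open import Relation.Nullary using (¬_; does)
open import Relation.Binary.PropositionalEquality using (_≡_; _≢_)

record Digraph : Set where
  field
    n m  : ℕ
    tail : Fin m → Fin n
    head : Fin m → Fin n
open Digraph public

∑ℤ : ∀ {k} → (Fin k → ℤ) → ℤ
∑ℤ {zero}  f = 0ℤ
∑ℤ {suc k} f = f zero ℤ.+ ∑ℤ (λ i → f (suc i))

∑ℚ : ∀ {k} → (Fin k → ℚ) → ℚ
∑ℚ {zero}  f = ℚ.0ℚ
∑ℚ {suc k} f = f zero ℚ.+ ∑ℚ (λ i → f (suc i))

toℚ : ℤ → ℚ
toℚ z = z ℚ./ 1

-- Undirected walks using only arcs from S (orientation ignored);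
-- fwd traverses an arc tail → head, bwd traverses it head → tail.

data Walk (G : Digraph) (S : Fin (m G) → Bool) : Fin (n G) → Fin (n G) → Set where
  []  : ∀ {v} → Walk G S v v
  fwd : ∀ {v} (e : Fin (m G)) → S e ≡ true → Walk G S (head G e) v → Walk G S (tail G e) v
  bwd : ∀ {v} (e : Fin (m G)) → S e ≡ true → Walk G S (tail G e) v → Walk G S (head G e) v

module _ {G : Digraph} {S : Fin (m G) → Bool} where

  arcs : ∀ {u v} → Walk G S u v → List (Fin (m G))
  arcs []          = []
  arcs (fwd e _ w) = e ∷ arcs w
  arcs (bwd e _ w) = e ∷ arcs w

  starts : ∀ {u v} → Walk G S u v → List (Fin (n G))
  starts []                = []
  starts {u} (fwd e _ w)   = u ∷ starts w
  starts {u} (bwd e _ w)   = u ∷ starts w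

  verts : ∀ {u v} → Walk G S u v → List (Fin (n G))
  verts {v = v} w = starts w ++ [ v ]

  IsPath : ∀ {u v} → Walk G S u v → Set
  IsPath w = Unique (verts w)

  χWalk : ∀ {u v} → Walk G S u v → Fin (m G) → ℤ
  χWalk []           e = 0ℤ
  χWalk (fwd e' _ w) e = (if does (e' ≟ e) then 1ℤ else 0ℤ) ℤ.+ χWalk w e
  χWalk (bwd e' _ w) e = (if does (e' ≟ e) then ℤ.- 1ℤ else 0ℤ) ℤ.+ χWalk w e

IsCycle : ∀ {G S v} → Walk G S v v → Set
IsCycle w = ¬ (arcs w ≡ []) × Unique (arcs w) × Unique (starts w)

all : ∀ {k} → Fin k → Bool
all _ = true

Connected : Digraph → Set
Connected G = ∀ u v → Walk G all u v

data Status : Set where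
  tree lower upper : Status

inT : Status → Bool
inT tree  = true
inT lower = false
inT upper = false

module _ (G : Digraph) (st : Fin (m G) → Status) where

  TreeArcs : Fin (m G) → Bool
  TreeArcs e = inT (st e)

  IsSpanningTree : Set
  IsSpanningTree = (∀ u v → Walk G TreeArcs u v)
                 × (∀ v (w : Walk G TreeArcs v v) → ¬ IsCycle w)

module _ (G : Digraph) (u : Fin (m G) → ℤ) (b : Fin (n G) → ℤ) where

  outflow inflow : (Fin (m G) → ℤ) → Fin (n G) → ℤ
  outflow f i = ∑ℤ (λ e → if does (tail G e ≟ i) then f e else 0ℤ)
  inflow  f i = ∑ℤ (λ e → if does (head G e ≟ i) then f e else 0ℤ)

  Feasible : (Fin (m G) → ℤ) → Set
  Feasible f = (∀ i → outflow f i ℤ.- inflow f i ≡ b i)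
             × (∀ e → 0ℤ ℤ.≤ f e × f e ℤ.≤ u e)

  IsTreeSolution : (Fin (m G) → ℤ) → (Fin (m G) → Status) → Set
  IsTreeSolution f st = Feasible f × IsSpanningTree G st
                      × (∀ e → st e ≡ lower → f e ≡ 0ℤ)
                      × (∀ e → st e ≡ upper → f e ≡ u e)

  cost : (Fin (m G) → ℚ) → (Fin (m G) → ℤ) → ℚ
  cost c f = ∑ℚ (λ e → c e ℚ.* toℚ (f e))

  Optimal : (Fin (m G) → ℚ) → (Fin (m G) → ℤ) → Set
  Optimal c f = Feasible f × (∀ g → Feasible g → cost c f ℚ.≤ cost c g)

-- P a : the tree path from head a (= j) to tail a (= i)
TreePaths : (G : Digraph) → (Fin (m G) → Status) → Set
TreePaths G st = (a : Fin (m G)) → Walk G (TreeArcs G st) (head G a) (tail G a)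

module _ (G : Digraph) (st : Fin (m G) → Status) (P : TreePaths G st) where

  unit : Fin (m G) → Fin (m G) → ℤ
  unit a e = if does (a ≟ e) then 1ℤ else 0ℤ

  -- χ(C_a): a followed by the tree path j ⇝ i, oriented along a if a ∈ L,
  -- against a if a ∈ U (zero vector for tree arcs, which index no cycle)
  χC : Fin (m G) → Fin (m G) → ℤ
  χC a e with st a
  ... | tree  = 0ℤ
  ... | lower = unit a e ℤ.+ χWalk (P a) e
  ... | upper = ℤ.- (unit a e ℤ.+ χWalk (P a) e)

  OnCycle : Fin (m G) → Fin (m G) → Set
  OnCycle a e = e ≡ a ⊎ e ∈ arcs (P a)

  cycleCost : (Fin (m G) → ℚ) → Fin (m G) → ℚ
  cycleCost c a = ∑ℚ (λ e → c e ℚ.* toℚ (χC a e))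

  -- Σ_{a ∉ T} λ_a χ(C_a)   (λ is supported on non-tree arcs)
  combo : (Fin (m G) → ℤ) → Fin (m G) → ℤ
  combo λ' e = ∑ℤ (λ a → λ' a ℤ.* χC a e)

  MMCIFFeasible : (u f : Fin (m G) → ℤ) (c² : Fin (m G) → ℚ) (ε : ℚ) → (Fin (m G) → ℤ) → Set
  MMCIFFeasible u f c² ε λ' =
      (∀ a → st a ≡ tree → λ' a ≡ 0ℤ)
    × (∀ e → (∃[ a ] (st a ≢ tree × OnCycle a e)) →
         (0ℤ ℤ.- f e ℤ.≤ combo λ' e) × (combo λ' e ℤ.≤ u e ℤ.- f e))
    × (∑ℚ (λ a → toℚ (λ' a) ℚ.* cycleCost c² a) ℚ.≤ ε)

{-# OPTIONS --safe #-}
-- For a feasible flow g put λ_a = ±(g_a − f_a) on the non-tree arcs a (the sign being the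
-- orientation of C_a).  The residual g − f − Σ_a λ_a χ(C_a) then has zero divergence and
-- vanishes off the spanning tree, and a circulation supported on a forest is zero: starting
-- from an arc carrying a nonzero value one can always leave the current endpoint along another
-- such arc, so the walk either closes a cycle or grows beyond the number of vertices.  Hence
-- g = f + Σ_a λ_a χ(C_a), the capacity constraints of (c-MMCIF) are those of g, and |λ_a| ≤ u_a
-- bounds the c²-cost of λ by a constant E that does not depend on g.  Conversely every cycle
-- vector has zero divergence, and (c-MMCIF) imposes the capacities on every arc it changes.
module Submission where

open import Defs
open import Data.Nat as ℕ using (zero; suc)
import Data.Nat.Properties as ℕP
open import Data.Fin using (Fin; zero; suc; _≟_)
import Data.Fin.Properties as FinP
open import Data.Integer as ℤ using (ℤ; 0ℤ; 1ℤ; -1ℤ; +_; -[1+_])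
import Data.Integer.Properties as ℤP
open import Data.Integer.Tactic.RingSolver using (solve-∀)
open import Data.Rational as ℚ using (ℚ; mkℚ; _⊔_)
import Data.Rational.Properties as ℚP
import Data.Nat.Coprimality as Coprimality
open import Data.Bool using (Bool; true; false; if_then_else_)
open import Data.List using (List; []; _∷_; _++_; length; lookup)
open import Data.List.Membership.Propositional using (_∈_; _∉_)
open import Data.List.Membership.Propositional.Properties using (∈-lookup; ∈-++⁺ˡ)
import Data.List.Membership.DecPropositional as DecMembership
open import Data.List.Relation.Unary.Any using (here; there)
import Data.List.Relation.Unary.All as All
open import Data.List.Relation.Unary.All.Properties using (++⁻ˡ; ++⁻ʳ; ¬Any⇒All¬)
open import Data.List.Relation.Unary.AllPairs using ([]; _∷_)
open import Data.List.Relation.Unary.Unique.Propositional using (Unique)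
open import Data.Sum using (inj₁; inj₂; [_,_])
open import Data.Product using (Σ-syntax; _×_; _,_; ∃-syntax; proj₁; proj₂)
open import Data.Empty using (⊥; ⊥-elim)
open import Function using (_∘_)
open import Function.Bundles using (_⇔_; mk⇔)
open import Relation.Nullary using (¬_; does; yes; no; Dec)
open import Relation.Nullary.Decidable
  using (_×-dec_; _⊎-dec_; ¬?; dec-true; dec-false; decidable-stable)
open import Relation.Binary.PropositionalEquality
  using (_≡_; _≢_; refl; sym; trans; cong; cong₂; subst; subst₂; module ≡-Reasoning)
open import Algebra.Properties.Semiring.Sum ℤP.+-*-semiring
  using (sum; sum-cong-≗; sum-replicate-zero; ∑-distrib-+; ∑-comm; *-distribˡ-sum)

open ≡-Reasoning

∑ℤ≡sum : ∀ {k} (f : Fin k → ℤ) → ∑ℤ f ≡ sum f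
∑ℤ≡sum {zero}  f = refl
∑ℤ≡sum {suc k} f = cong (ℤ._+_ (f zero)) (∑ℤ≡sum (λ i → f (suc i)))

sum-zero : ∀ {k} {f : Fin k → ℤ} → (∀ i → f i ≡ 0ℤ) → sum f ≡ 0ℤ
sum-zero {k} f≡0 = trans (sum-cong-≗ f≡0) (sum-replicate-zero k)

sum-neg : ∀ {k} (f : Fin k → ℤ) → sum (λ i → ℤ.- f i) ≡ ℤ.- sum f
sum-neg f = begin
  sum (λ i → ℤ.- f i)     ≡⟨ sum-cong-≗ (λ i → sym (ℤP.-1*i≡-i (f i))) ⟩
  sum (λ i → -1ℤ ℤ.* f i) ≡⟨ sym (*-distribˡ-sum -1ℤ f) ⟩
  -1ℤ ℤ.* sum f           ≡⟨ ℤP.-1*i≡-i (sum f) ⟩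
  ℤ.- sum f               ∎

sum-− : ∀ {k} (f g : Fin k → ℤ) → sum (λ i → f i ℤ.- g i) ≡ sum f ℤ.- sum g
sum-− f g = trans (∑-distrib-+ f (λ i → ℤ.- g i)) (cong (ℤ._+_ (sum f)) (sum-neg g))

sum-single : ∀ {k} (f : Fin k → ℤ) a → (∀ i → i ≢ a → f i ≡ 0ℤ) → sum f ≡ f a
sum-single f zero others =
  trans (cong (ℤ._+_ (f zero)) (sum-zero (λ i → others (suc i) λ ()))) (ℤP.+-identityʳ (f zero))
sum-single f (suc a) others =
  trans (cong₂ ℤ._+_ (others zero λ ()) (sum-single (f ∘ suc) a others∘suc)) (ℤP.+-identityˡ _)
  where
  others∘suc : ∀ i → i ≢ a → f (suc i) ≡ 0ℤ
  others∘suc i i≢a = others (suc i) (i≢a ∘ FinP.suc-injective)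

sum≡0⇒other≢0 : ∀ {k} (f : Fin k → ℤ) a → sum f ≡ 0ℤ → f a ≢ 0ℤ → ∃[ b ] (b ≢ a × f b ≢ 0ℤ)
sum≡0⇒other≢0 f a sum≡0 fa≢0 with FinP.any? (λ b → ¬? (b ≟ a) ×-dec ¬? (f b ℤP.≟ 0ℤ))
... | yes found = found
... | no none   = ⊥-elim (fa≢0 (trans (sym (sum-single f a others≡0)) sum≡0))
  where
  others≡0 : ∀ b → b ≢ a → f b ≡ 0ℤ
  others≡0 b b≢a = decidable-stable (f b ℤP.≟ 0ℤ) (λ fb≢0 → none (b , b≢a , fb≢0))

∑ℚ-mono-≤ : ∀ {k} {f g : Fin k → ℚ} → (∀ i → f i ℚ.≤ g i) → ∑ℚ f ℚ.≤ ∑ℚ g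
∑ℚ-mono-≤ {zero}  f≤g = ℚP.≤-refl
∑ℚ-mono-≤ {suc k} f≤g = ℚP.+-mono-≤ (f≤g zero) (∑ℚ-mono-≤ (f≤g ∘ suc))

*-≢0 : ∀ {i j} → i ≢ 0ℤ → j ≢ 0ℤ → i ℤ.* j ≢ 0ℤ
*-≢0 {i} i≢0 j≢0 ij≡0 = [ i≢0 , j≢0 ] (ℤP.i*j≡0⇒i≡0∨j≡0 i ij≡0)

difference-bounded : ∀ {x y U} → 0ℤ ℤ.≤ x → x ℤ.≤ U → 0ℤ ℤ.≤ y → y ℤ.≤ U →
                     ℤ.- U ℤ.≤ x ℤ.- y × x ℤ.- y ℤ.≤ U
difference-bounded {x} {y} {U} 0≤x x≤U 0≤y y≤U =
  subst (ℤ._≤ x ℤ.- y) (ℤP.+-identityˡ (ℤ.- U)) (ℤP.+-mono-≤ 0≤x (ℤP.neg-mono-≤ y≤U)) ,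
  subst (x ℤ.- y ℤ.≤_) (ℤP.+-identityʳ U) (ℤP.+-mono-≤ x≤U (ℤP.neg-mono-≤ 0≤y))

interval-translate : ∀ d {lo x hi} → lo ℤ.- d ℤ.≤ x → x ℤ.≤ hi ℤ.- d →
                     lo ℤ.≤ d ℤ.+ x × d ℤ.+ x ℤ.≤ hi
interval-translate d {lo} {x} {hi} lo-d≤x x≤hi-d =
  subst (ℤ._≤ d ℤ.+ x) (cancel lo d) (ℤP.+-monoʳ-≤ d lo-d≤x) ,
  subst (d ℤ.+ x ℤ.≤_) (cancel hi d) (ℤP.+-monoʳ-≤ d x≤hi-d)
  where
  cancel : ∀ a d → d ℤ.+ (a ℤ.- d) ≡ a
  cancel = solve-∀

indicator : Bool → ℤ
indicator b = if b then 1ℤ else 0ℤ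

if-then-0≡indicator* : ∀ b x → (if b then x else 0ℤ) ≡ indicator b ℤ.* x
if-then-0≡indicator* true  x = sym (ℤP.*-identityˡ x)
if-then-0≡indicator* false x = refl

δ : ∀ {k} → Fin k → Fin k → ℤ
δ x y = indicator (does (x ≟ y))

δ-refl : ∀ {k} (x : Fin k) → δ x x ≡ 1ℤ
δ-refl x = cong indicator (dec-true (x ≟ x) refl)

δ-≢ : ∀ {k} {x y : Fin k} → x ≢ y → δ x y ≡ 0ℤ
δ-≢ {x = x} {y} x≢y = cong indicator (dec-false (x ≟ y) x≢y)

toℚ≡mkℚ : ∀ z → toℚ z ≡ mkℚ z 0 (Coprimality.sym (Coprimality.1-coprimeTo ℤ.∣ z ∣))
toℚ≡mkℚ (+ k)    = ℚP.normalize-coprime (Coprimality.sym (Coprimality.1-coprimeTo k))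
toℚ≡mkℚ -[1+ k ] = cong ℚ.-_ (ℚP.normalize-coprime (Coprimality.sym (Coprimality.1-coprimeTo (suc k))))

toℚ-mono-≤ : ∀ {x y} → x ℤ.≤ y → toℚ x ℚ.≤ toℚ y
toℚ-mono-≤ {x} {y} x≤y rewrite toℚ≡mkℚ x | toℚ≡mkℚ y =
  ℚ.*≤* (subst₂ ℤ._≤_ (sym (ℤP.*-identityʳ x)) (sym (ℤP.*-identityʳ y)) x≤y)

*-bounded-by-endpoints : ∀ {lo x hi} c → lo ℚ.≤ x → x ℚ.≤ hi → x ℚ.* c ℚ.≤ hi ℚ.* c ⊔ lo ℚ.* c
*-bounded-by-endpoints {lo} {x} {hi} c lo≤x x≤hi with ℚP.≤-total ℚ.0ℚ c
... | inj₁ 0≤c =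
  ℚP.≤-trans (ℚP.*-monoʳ-≤-nonNeg c {{ℚ.nonNegative 0≤c}} x≤hi) (ℚP.p≤p⊔q (hi ℚ.* c) (lo ℚ.* c))
... | inj₂ c≤0 =
  ℚP.≤-trans (ℚP.*-monoʳ-≤-nonPos c {{ℚ.nonPositive c≤0}} lo≤x) (ℚP.p≤q⊔p (hi ℚ.* c) (lo ℚ.* c))

module _ {A : Set} where

  Unique-∷ : ∀ {x} {xs : List A} → x ∉ xs → Unique xs → Unique (x ∷ xs)
  Unique-∷ {xs = xs} x∉xs u = ¬Any⇒All¬ xs x∉xs ∷ u

  Unique-++⁻ˡ : ∀ xs {ys : List A} → Unique (xs ++ ys) → Unique xs
  Unique-++⁻ˡ []       _        = []
  Unique-++⁻ˡ (x ∷ xs) (x∉ ∷ u) = ++⁻ˡ xs x∉ ∷ Unique-++⁻ˡ xs u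

  Unique-++⇒∉ : ∀ xs {ys : List A} {y} → Unique (xs ++ ys) → y ∈ ys → y ∉ xs
  Unique-++⇒∉ (x ∷ xs) (x∉ ∷ _) y∈ys (here refl)   = All.lookup (++⁻ʳ xs x∉) y∈ys refl
  Unique-++⇒∉ (x ∷ xs) (_ ∷ u)  y∈ys (there y∈xs) = Unique-++⇒∉ xs u y∈ys y∈xs

  lookup-injective : ∀ {xs : List A} → Unique xs → ∀ i j → lookup xs i ≡ lookup xs j → i ≡ j
  lookup-injective {_ ∷ _}  _         zero    zero    _  = refl
  lookup-injective {_ ∷ _}  (x∉ ∷ _)  zero    (suc j) eq = ⊥-elim (All.lookup x∉ (∈-lookup j) eq)
  lookup-injective {_ ∷ _}  (x∉ ∷ _)  (suc i) zero    eq = ⊥-elim (All.lookup x∉ (∈-lookup i) (sym eq))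
  lookup-injective {_ ∷ _}  (_ ∷ u)   (suc i) (suc j) eq = cong suc (lookup-injective u i j eq)

Unique⇒length≤ : ∀ {k} {xs : List (Fin k)} → Unique xs → length xs ℕ.≤ k
Unique⇒length≤ u = FinP.injective⇒≤ (λ {i} {j} → lookup-injective u i j)

module _ (G : Digraph) where

  data Incident (e : Fin (m G)) : Fin (n G) → Set where
    at-tail : Incident e (tail G e)
    at-head : Incident e (head G e)

  incidence : Fin (n G) → Fin (m G) → ℤ
  incidence i e = δ (tail G e) i ℤ.- δ (head G e) i

  divergence : (Fin (m G) → ℤ) → Fin (n G) → ℤ
  divergence h i = sum (λ e → incidence i e ℤ.* h e)

  incident⇒incidence≢0 : ∀ {e x} → tail G e ≢ head G e → Incident e x → incidence x e ≢ 0ℤ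
  incident⇒incidence≢0 {e} t≢h at-tail eq with () ←
    trans (sym (cong₂ ℤ._-_ (δ-refl (tail G e)) (δ-≢ (t≢h ∘ sym)))) eq
  incident⇒incidence≢0 {e} t≢h at-head eq with () ←
    trans (sym (cong₂ ℤ._-_ (δ-≢ t≢h) (δ-refl (head G e)))) eq

  incidence≢0⇒incident : ∀ {e x} → incidence x e ≢ 0ℤ → Incident e x
  incidence≢0⇒incident {e} {x} inc≢0 with tail G e ≟ x | head G e ≟ x
  ... | yes refl | _        = at-tail
  ... | no _     | yes refl = at-head
  ... | no _     | no _     = ⊥-elim (inc≢0 refl)

  outflow-inflow≡divergence : ∀ u b h i → outflow G u b h i ℤ.- inflow G u b h i ≡ divergence h i
  outflow-inflow≡divergence u b h i = begin
      outflow G u b h i ℤ.- inflow G u b h i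
    ≡⟨ cong₂ ℤ._-_ (∑ℤ≡sum out) (∑ℤ≡sum in′) ⟩
      sum out ℤ.- sum in′
    ≡⟨ sym (sum-− out in′) ⟩
      sum (λ e → out e ℤ.- in′ e)
    ≡⟨ sum-cong-≗ per-arc ⟩
      divergence h i ∎
    where
    out in′ : Fin (m G) → ℤ
    out e = if does (tail G e ≟ i) then h e else 0ℤ
    in′ e = if does (head G e ≟ i) then h e else 0ℤ
    factor : ∀ a b x → a ℤ.* x ℤ.- b ℤ.* x ≡ (a ℤ.- b) ℤ.* x
    factor = solve-∀
    per-arc : ∀ e → out e ℤ.- in′ e ≡ incidence i e ℤ.* h e
    per-arc e = trans (cong₂ ℤ._-_ (if-then-0≡indicator* (does (tail G e ≟ i)) (h e))
                                     (if-then-0≡indicator* (does (head G e ≟ i)) (h e)))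
                      (factor (δ (tail G e) i) (δ (head G e) i) (h e))

  divergence-cong : ∀ {h k} → (∀ e → h e ≡ k e) → ∀ i → divergence h i ≡ divergence k i
  divergence-cong h≗k i = sum-cong-≗ (λ e → cong (incidence i e ℤ.*_) (h≗k e))

  divergence-+ : ∀ h k i → divergence (λ e → h e ℤ.+ k e) i ≡ divergence h i ℤ.+ divergence k i
  divergence-+ h k i =
    trans (sum-cong-≗ (λ e → ℤP.*-distribˡ-+ (incidence i e) (h e) (k e)))
          (∑-distrib-+ (λ e → incidence i e ℤ.* h e) (λ e → incidence i e ℤ.* k e))

  divergence-− : ∀ h k i → divergence (λ e → h e ℤ.- k e) i ≡ divergence h i ℤ.- divergence k i
  divergence-− h k i =
    trans (sum-cong-≗ (λ e → distrib (incidence i e) (h e) (k e)))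
          (sum-− (λ e → incidence i e ℤ.* h e) (λ e → incidence i e ℤ.* k e))
    where
    distrib : ∀ a x y → a ℤ.* (x ℤ.- y) ≡ a ℤ.* x ℤ.- a ℤ.* y
    distrib = solve-∀

  divergence-scale : ∀ c h i → divergence (λ e → c ℤ.* h e) i ≡ c ℤ.* divergence h i
  divergence-scale c h i =
    trans (sum-cong-≗ (λ e → swap (incidence i e) c (h e)))
          (sym (*-distribˡ-sum c (λ e → incidence i e ℤ.* h e)))
    where
    swap : ∀ a c x → a ℤ.* (c ℤ.* x) ≡ c ℤ.* (a ℤ.* x)
    swap = solve-∀

  divergence-sum : ∀ {k} (H : Fin k → Fin (m G) → ℤ) i →
                   divergence (λ e → sum (λ a → H a e)) i ≡ sum (λ a → divergence (H a) i)
  divergence-sum H i =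
    trans (sum-cong-≗ (λ e → *-distribˡ-sum (incidence i e) (λ a → H a e)))
          (∑-comm (λ e a → incidence i e ℤ.* H a e))

  divergence-single : ∀ a c i →
                      divergence (λ e → if does (a ≟ e) then c else 0ℤ) i ≡ incidence i a ℤ.* c
  divergence-single a c i = begin
      divergence (λ e → if does (a ≟ e) then c else 0ℤ) i
    ≡⟨ sum-single _ a off-a ⟩
      incidence i a ℤ.* (if does (a ≟ a) then c else 0ℤ)
    ≡⟨ cong (λ b → incidence i a ℤ.* (if b then c else 0ℤ)) (dec-true (a ≟ a) refl) ⟩
      incidence i a ℤ.* c ∎
    where
    off-a : ∀ e → e ≢ a → incidence i e ℤ.* (if does (a ≟ e) then c else 0ℤ) ≡ 0ℤ
    off-a e e≢a rewrite dec-false (a ≟ e) (e≢a ∘ sym) = ℤP.*-zeroʳ (incidence i e)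

  divergence-χWalk : ∀ {S x y} (w : Walk G S x y) i → divergence (χWalk w) i ≡ δ x i ℤ.- δ y i
  divergence-χWalk {x = x} [] i =
    trans (sum-zero (λ e → ℤP.*-zeroʳ (incidence i e))) (sym (ℤP.+-inverseʳ (δ x i)))
  divergence-χWalk {y = y} (fwd e _ w) i =
    trans (divergence-+ (δ e) (χWalk w) i)
          (trans (cong₂ ℤ._+_ (divergence-single e 1ℤ i) (divergence-χWalk w i))
                 (telescope (δ (tail G e) i) (δ (head G e) i) (δ y i)))
    where
    telescope : ∀ t h y → (t ℤ.- h) ℤ.* 1ℤ ℤ.+ (h ℤ.- y) ≡ t ℤ.- y
    telescope = solve-∀
  divergence-χWalk {y = y} (bwd e _ w) i =
    trans (divergence-+ (λ e′ → if does (e ≟ e′) then -1ℤ else 0ℤ) (χWalk w) i)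
          (trans (cong₂ ℤ._+_ (divergence-single e -1ℤ i) (divergence-χWalk w i))
                 (telescope (δ (tail G e) i) (δ (head G e) i) (δ y i)))
    where
    telescope : ∀ t h y → (t ℤ.- h) ℤ.* -1ℤ ℤ.+ (t ℤ.- y) ≡ h ℤ.- y
    telescope = solve-∀

module _ {G : Digraph} where

  opposite : ∀ {e x} → Incident G e x → Fin (n G)
  opposite {e} at-tail = head G e
  opposite {e} at-head = tail G e

  opposite-incident : ∀ {e x} (i : Incident G e x) → Incident G e (opposite i)
  opposite-incident at-tail = at-head
  opposite-incident at-head = at-tail

module _ {G : Digraph} {S : Fin (m G) → Bool} where

  ∈-arcs⇒S : ∀ {x y} (w : Walk G S x y) {e} → e ∈ arcs w → S e ≡ true
  ∈-arcs⇒S (fwd e s w) (here refl) = s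
  ∈-arcs⇒S (fwd e s w) (there e∈) = ∈-arcs⇒S w e∈
  ∈-arcs⇒S (bwd e s w) (here refl) = s
  ∈-arcs⇒S (bwd e s w) (there e∈) = ∈-arcs⇒S w e∈

  χWalk-outside : ∀ {x y} (w : Walk G S x y) {e} → e ∉ arcs w → χWalk w e ≡ 0ℤ
  χWalk-outside []           e∉ = refl
  χWalk-outside (fwd e′ _ w) {e} e∉ rewrite dec-false (e′ ≟ e) (λ { refl → e∉ (here refl) }) =
    trans (ℤP.+-identityˡ _) (χWalk-outside w (e∉ ∘ there))
  χWalk-outside (bwd e′ _ w) {e} e∉ rewrite dec-false (e′ ≟ e) (λ { refl → e∉ (here refl) }) =
    trans (ℤP.+-identityˡ _) (χWalk-outside w (e∉ ∘ there))

  start∈verts : ∀ {x y} (w : Walk G S x y) → x ∈ verts w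
  start∈verts []          = here refl
  start∈verts (fwd _ _ _) = here refl
  start∈verts (bwd _ _ _) = here refl

  incident-∈-verts : ∀ {x y a z} (w : Walk G S x y) → a ∈ arcs w → Incident G a z → z ∈ verts w
  incident-∈-verts (fwd e _ w) (here refl) at-tail = here refl
  incident-∈-verts (fwd e _ w) (here refl) at-head = there (start∈verts w)
  incident-∈-verts (bwd e _ w) (here refl) at-tail = there (start∈verts w)
  incident-∈-verts (bwd e _ w) (here refl) at-head = here refl
  incident-∈-verts (fwd e _ w) (there a∈) inc = there (incident-∈-verts w a∈ inc)
  incident-∈-verts (bwd e _ w) (there a∈) inc = there (incident-∈-verts w a∈ inc)

  prepend : ∀ {e x v} → S e ≡ true → (i : Incident G e x) → Walk G S x v → Walk G S (opposite i) v
  prepend {e} s at-tail w = bwd e s w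
  prepend {e} s at-head w = fwd e s w

  arcs-prepend : ∀ {e x v} s (i : Incident G e x) (w : Walk G S x v) → arcs (prepend s i w) ≡ e ∷ arcs w
  arcs-prepend s at-tail w = refl
  arcs-prepend s at-head w = refl

  verts-prepend : ∀ {e x v} s (i : Incident G e x) (w : Walk G S x v) →
                  verts (prepend s i w) ≡ opposite i ∷ verts w
  verts-prepend s at-tail w = refl
  verts-prepend s at-head w = refl

  prepend-isCycle : ∀ {e x} s (i : Incident G e x) (p : Walk G S x (opposite i)) →
                    e ∉ arcs p → Unique (arcs p) → opposite i ∉ starts p → Unique (starts p) →
                    IsCycle (prepend s i p)
  prepend-isCycle s at-tail p e∉ ua y∉ us = (λ ()) , Unique-∷ e∉ ua , Unique-∷ y∉ us
  prepend-isCycle s at-head p e∉ ua y∉ us = (λ ()) , Unique-∷ e∉ ua , Unique-∷ y∉ us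

  stay : ∀ {x y} → x ≡ y → Walk G S x y
  stay refl = []

  arcs-stay : ∀ {x y} (x≡y : x ≡ y) → arcs (stay x≡y) ≡ []
  arcs-stay refl = refl

  starts-stay : ∀ {x y} (x≡y : x ≡ y) → starts (stay x≡y) ≡ []
  starts-stay refl = refl

  record Split {x v} (w : Walk G S x v) (y : Fin (n G)) : Set where
    field
      before      : Walk G S x y
      after       : Walk G S y v
      arcs-split  : arcs w ≡ arcs before ++ arcs after
      verts-split : verts w ≡ starts before ++ verts after

  splitAt : ∀ {x v y} (w : Walk G S x v) → y ∈ verts w → Split w y
  splitAt []          (here refl) = record { before = [] ; after = [] ; arcs-split = refl ; verts-split = refl }
  splitAt (fwd e s w) (here refl) = record { before = [] ; after = fwd e s w ; arcs-split = refl ; verts-split = refl }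
  splitAt (bwd e s w) (here refl) = record { before = [] ; after = bwd e s w ; arcs-split = refl ; verts-split = refl }
  splitAt (fwd e s w) (there y∈) = record
    { before = fwd e s before ; after = after
    ; arcs-split = cong (e ∷_) arcs-split ; verts-split = cong (tail G e ∷_) verts-split }
    where open Split (splitAt w y∈)
  splitAt (bwd e s w) (there y∈) = record
    { before = bwd e s before ; after = after
    ; arcs-split = cong (e ∷_) arcs-split ; verts-split = cong (head G e ∷_) verts-split }
    where open Split (splitAt w y∈)

module _ {G : Digraph} {S : Fin (m G) → Bool}
         (acyclic : ∀ v (w : Walk G S v v) → ¬ IsCycle w) where

  loopless : ∀ e → S e ≡ true → tail G e ≢ head G e
  loopless e s t≡h = acyclic (tail G e) loop loop-isCycle
    where
    loop : Walk G S (tail G e) (tail G e)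
    loop = fwd e s (stay (sym t≡h))
    loop-isCycle : IsCycle loop
    loop-isCycle =
      (λ ()) ,
      subst (λ as → Unique (e ∷ as)) (sym (arcs-stay (sym t≡h))) (All.[] ∷ []) ,
      subst (λ vs → Unique (tail G e ∷ vs)) (sym (starts-stay (sym t≡h))) (All.[] ∷ [])

  module _ (h : Fin (m G) → ℤ) (h-off-S : ∀ e → S e ≡ false → h e ≡ 0ℤ)
           (h-circulation : ∀ i → divergence G h i ≡ 0ℤ) where

    support⊆S : ∀ {e} → h e ≢ 0ℤ → S e ≡ true
    support⊆S {e} he≢0 with S e in Se
    ... | true  = refl
    ... | false = ⊥-elim (he≢0 (h-off-S e Se))

    another-arc : ∀ {x} e → h e ≢ 0ℤ → Incident G e x →
                  ∃[ e′ ] (e′ ≢ e × h e′ ≢ 0ℤ × Incident G e′ x)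
    another-arc {x} e he≢0 e-inc
      with sum≡0⇒other≢0 (λ a → incidence G x a ℤ.* h a) e (h-circulation x)
                         (*-≢0 (incident⇒incidence≢0 G (loopless e (support⊆S he≢0)) e-inc) he≢0)
    ... | e′ , e′≢e , term≢0 =
      e′ , e′≢e , he′≢0 , incidence≢0⇒incident G (λ inc≡0 → term≢0 (cong (ℤ._* h e′) inc≡0))
      where
      he′≢0 : h e′ ≢ 0ℤ
      he′≢0 he′≡0 =
        term≢0 (trans (cong (incidence G x e′ ℤ.*_) he′≡0) (ℤP.*-zeroʳ (incidence G x e′)))

    -- The walk runs from its growing end x back to its origin; lead is the arc through which it
    -- last grew (for the empty walk, any arc at x carrying a nonzero value).
    record Trail (x : Fin (n G)) : Set where
      field
        origin            : Fin (n G)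
        walk              : Walk G S x origin
        lead              : Fin (m G)
        lead-nonzero      : h lead ≢ 0ℤ
        lead-incident     : Incident G lead x
        lead-only         : ∀ {a} → a ∈ arcs walk → a ≢ lead → ¬ Incident G a x
        vertices-distinct : Unique (verts walk)
        arcs-distinct     : Unique (arcs walk)
    open Trail

    fresh-endpoint : ∀ {x e} (t : Trail x) → h e ≢ 0ℤ → e ≢ lead t → (i : Incident G e x) →
                     opposite i ∉ verts (walk t)
    fresh-endpoint {e = e} t he≢0 e≢lead i y∈ =
      acyclic _ (prepend s i before)
        (prepend-isCycle s i before e∉before (Unique-++⁻ˡ (arcs before) arcs-unique)
                         (Unique-++⇒∉ (starts before) verts-unique (start∈verts after))
                         (Unique-++⁻ˡ (starts before) verts-unique))
      where
      open Split (splitAt (walk t) y∈)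
      s = support⊆S he≢0
      arcs-unique : Unique (arcs before ++ arcs after)
      arcs-unique = subst Unique arcs-split (arcs-distinct t)
      verts-unique : Unique (starts before ++ verts after)
      verts-unique = subst Unique verts-split (vertices-distinct t)
      e∉before : e ∉ arcs before
      e∉before e∈ = lead-only t (subst (e ∈_) (sym arcs-split) (∈-++⁺ˡ e∈)) e≢lead i

    extend : ∀ {x} (t : Trail x) →
             Σ[ y ∈ Fin (n G) ] Σ[ t′ ∈ Trail y ] length (verts (walk t′)) ≡ suc (length (verts (walk t)))
    extend {x} t with another-arc (lead t) (lead-nonzero t) (lead-incident t)
    ... | e , e≢lead , he≢0 , i = opposite i , trail′ , cong length (verts-prepend s i (walk t))
      where
      s = support⊆S he≢0
      y∉ : opposite i ∉ verts (walk t)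
      y∉ = fresh-endpoint t he≢0 e≢lead i
      e∉ : e ∉ arcs (walk t)
      e∉ e∈ = lead-only t e∈ e≢lead i
      only-e : ∀ {a} → a ∈ arcs (prepend s i (walk t)) → a ≢ e → ¬ Incident G a (opposite i)
      only-e a∈ a≢e a-inc with subst (_ ∈_) (arcs-prepend s i (walk t)) a∈
      ... | here refl = a≢e refl
      ... | there a∈w = y∉ (incident-∈-verts (walk t) a∈w a-inc)
      trail′ : Trail (opposite i)
      trail′ = record
        { origin            = origin t
        ; walk              = prepend s i (walk t)
        ; lead              = e
        ; lead-nonzero      = he≢0
        ; lead-incident     = opposite-incident i
        ; lead-only         = only-e
        ; vertices-distinct = subst Unique (sym (verts-prepend s i (walk t)))
                                    (Unique-∷ y∉ (vertices-distinct t))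
        ; arcs-distinct     = subst Unique (sym (arcs-prepend s i (walk t))) (Unique-∷ e∉ (arcs-distinct t))
        }

    trail-length-bound : ∀ k {x} (t : Trail x) → k ℕ.+ length (verts (walk t)) ℕ.≤ n G
    trail-length-bound zero    t = Unique⇒length≤ (vertices-distinct t)
    trail-length-bound (suc k) t with extend t
    ... | _ , t′ , len≡ =
      subst (ℕ._≤ n G) (trans (cong (k ℕ.+_) len≡) (ℕP.+-suc k _)) (trail-length-bound k t′)

    no-trail : ∀ {x} → Trail x → ⊥
    no-trail t = ℕP.n≮n (n G) (ℕP.m+n≤o⇒m≤o (suc (n G)) (trail-length-bound (suc (n G)) t))

    empty-trail : ∀ e → h e ≢ 0ℤ → Trail (tail G e)
    empty-trail e he≢0 = record
      { origin            = tail G e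
      ; walk              = []
      ; lead              = e
      ; lead-nonzero      = he≢0
      ; lead-incident     = at-tail
      ; lead-only         = λ ()
      ; vertices-distinct = All.[] ∷ []
      ; arcs-distinct     = []
      }

    circulation-on-forest≡0 : ∀ e → h e ≡ 0ℤ
    circulation-on-forest≡0 e = decidable-stable (h e ℤP.≟ 0ℤ) (λ he≢0 → no-trail (empty-trail e he≢0))

orientation : Status → ℤ
orientation tree  = 0ℤ
orientation lower = 1ℤ
orientation upper = -1ℤ

isTree? : ∀ s → Dec (s ≡ tree)
isTree? tree  = yes refl
isTree? lower = no λ ()
isTree? upper = no λ ()

inT≡true⇒tree : ∀ {s} → inT s ≡ true → s ≡ tree
inT≡true⇒tree {tree} _ = refl

inT≡false⇒≢tree : ∀ {s} → inT s ≡ false → s ≢ tree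
inT≡false⇒≢tree () refl

orientation-involutive : ∀ {s} → s ≢ tree → ∀ d → orientation s ℤ.* d ℤ.* orientation s ≡ d
orientation-involutive {tree}  s≢tree = ⊥-elim (s≢tree refl)
orientation-involutive {lower} _      = solve-∀
orientation-involutive {upper} _      = solve-∀

orientation-*-bounded : ∀ s {U d} → 0ℤ ℤ.≤ U → ℤ.- U ℤ.≤ d × d ℤ.≤ U →
                        ℤ.- U ℤ.≤ orientation s ℤ.* d × orientation s ℤ.* d ℤ.≤ U
orientation-*-bounded tree  0≤U _ = ℤP.neg-mono-≤ 0≤U , 0≤U
orientation-*-bounded lower {U} {d} _ (-U≤d , d≤U) =
  subst (λ x → ℤ.- U ℤ.≤ x × x ℤ.≤ U) (sym (ℤP.*-identityˡ d)) (-U≤d , d≤U)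
orientation-*-bounded upper {U} {d} _ (-U≤d , d≤U) =
  subst (λ x → ℤ.- U ℤ.≤ x × x ℤ.≤ U) (sym (ℤP.-1*i≡-i d))
        (ℤP.neg-mono-≤ d≤U , subst (ℤ.- d ℤ.≤_) (ℤP.neg-involutive U) (ℤP.neg-mono-≤ -U≤d))

cycleCoordinates : ∀ {k} → (Fin k → Status) → (f g : Fin k → ℤ) → Fin k → ℤ
cycleCoordinates st f g a = orientation (st a) ℤ.* (g a ℤ.- f a)

module _ (G : Digraph) (st : Fin (m G) → Status) (P : TreePaths G st) where

  χAlong : Fin (m G) → Fin (m G) → ℤ
  χAlong a e = δ a e ℤ.+ χWalk (P a) e

  χC≡orientation*χAlong : ∀ a e → χC G st P a e ≡ orientation (st a) ℤ.* χAlong a e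
  χC≡orientation*χAlong a e with st a
  ... | tree  = refl
  ... | lower = sym (ℤP.*-identityˡ _)
  ... | upper = sym (ℤP.-1*i≡-i _)

  divergence-χAlong : ∀ a i → divergence G (χAlong a) i ≡ 0ℤ
  divergence-χAlong a i = begin
      divergence G (χAlong a) i
    ≡⟨ divergence-+ G (δ a) (χWalk (P a)) i ⟩
      divergence G (δ a) i ℤ.+ divergence G (χWalk (P a)) i
    ≡⟨ cong₂ ℤ._+_ (divergence-single G a 1ℤ i) (divergence-χWalk G (P a) i) ⟩
      incidence G i a ℤ.* 1ℤ ℤ.+ (δ (head G a) i ℤ.- δ (tail G a) i)
    ≡⟨ cancel (δ (tail G a) i) (δ (head G a) i) ⟩
      0ℤ ∎
    where
    cancel : ∀ t h → (t ℤ.- h) ℤ.* 1ℤ ℤ.+ (h ℤ.- t) ≡ 0ℤ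
    cancel = solve-∀

  divergence-χC : ∀ a i → divergence G (χC G st P a) i ≡ 0ℤ
  divergence-χC a i = begin
      divergence G (χC G st P a) i
    ≡⟨ divergence-cong G (χC≡orientation*χAlong a) i ⟩
      divergence G (λ e → orientation (st a) ℤ.* χAlong a e) i
    ≡⟨ divergence-scale G (orientation (st a)) (χAlong a) i ⟩
      orientation (st a) ℤ.* divergence G (χAlong a) i
    ≡⟨ cong (orientation (st a) ℤ.*_) (divergence-χAlong a i) ⟩
      orientation (st a) ℤ.* 0ℤ
    ≡⟨ ℤP.*-zeroʳ (orientation (st a)) ⟩
      0ℤ ∎

  divergence-combo : ∀ λ′ i → divergence G (combo G st P λ′) i ≡ 0ℤ
  divergence-combo λ′ i = begin
      divergence G (combo G st P λ′) i
    ≡⟨ divergence-cong G (λ e → ∑ℤ≡sum (λ a → λ′ a ℤ.* χC G st P a e)) i ⟩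
      divergence G (λ e → sum (λ a → λ′ a ℤ.* χC G st P a e)) i
    ≡⟨ divergence-sum G (λ a e → λ′ a ℤ.* χC G st P a e) i ⟩
      sum (λ a → divergence G (λ e → λ′ a ℤ.* χC G st P a e) i)
    ≡⟨ sum-zero term≡0 ⟩
      0ℤ ∎
    where
    term≡0 : ∀ a → divergence G (λ e → λ′ a ℤ.* χC G st P a e) i ≡ 0ℤ
    term≡0 a = trans (divergence-scale G (λ′ a) (χC G st P a) i)
                     (trans (cong (λ′ a ℤ.*_) (divergence-χC a i)) (ℤP.*-zeroʳ (λ′ a)))

  treePath-avoids-nontree : ∀ a {e} → st e ≢ tree → e ∉ arcs (P a)
  treePath-avoids-nontree a e≢tree e∈ = e≢tree (inT≡true⇒tree (∈-arcs⇒S (P a) e∈))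

  χC-outside : ∀ {a e} → (st a ≢ tree → ¬ OnCycle G st P a e) → χC G st P a e ≡ 0ℤ
  χC-outside {a} {e} off with isTree? (st a)
  ... | yes a-tree =
    trans (χC≡orientation*χAlong a e) (cong (λ s → orientation s ℤ.* χAlong a e) a-tree)
  ... | no  a∉tree =
    trans (χC≡orientation*χAlong a e)
          (trans (cong (orientation (st a) ℤ.*_) χAlong≡0) (ℤP.*-zeroʳ (orientation (st a))))
    where
    χAlong≡0 : χAlong a e ≡ 0ℤ
    χAlong≡0 = cong₂ ℤ._+_ (δ-≢ (off a∉tree ∘ inj₁ ∘ sym)) (χWalk-outside (P a) (off a∉tree ∘ inj₂))

  χC-diagonal : ∀ {a} → st a ≢ tree → χC G st P a a ≡ orientation (st a)
  χC-diagonal {a} a∉tree =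
    trans (χC≡orientation*χAlong a a)
          (trans (cong (orientation (st a) ℤ.*_)
                       (cong₂ ℤ._+_ (δ-refl a) (χWalk-outside (P a) (treePath-avoids-nontree a a∉tree))))
                 (ℤP.*-identityʳ (orientation (st a))))

  combo-nontree : ∀ λ′ {e} → st e ≢ tree → combo G st P λ′ e ≡ λ′ e ℤ.* orientation (st e)
  combo-nontree λ′ {e} e∉tree = begin
      combo G st P λ′ e
    ≡⟨ ∑ℤ≡sum (λ a → λ′ a ℤ.* χC G st P a e) ⟩
      sum (λ a → λ′ a ℤ.* χC G st P a e)
    ≡⟨ sum-single (λ a → λ′ a ℤ.* χC G st P a e) e off-diagonal ⟩
      λ′ e ℤ.* χC G st P e e
    ≡⟨ cong (λ′ e ℤ.*_) (χC-diagonal e∉tree) ⟩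
      λ′ e ℤ.* orientation (st e) ∎
    where
    off-diagonal : ∀ a → a ≢ e → λ′ a ℤ.* χC G st P a e ≡ 0ℤ
    off-diagonal a a≢e =
      trans (cong (λ′ a ℤ.*_) (χC-outside (λ _ → [ a≢e ∘ sym , treePath-avoids-nontree a e∉tree ])))
            (ℤP.*-zeroʳ (λ′ a))

  combo-outside : ∀ λ′ {e} → ¬ (∃[ a ] (st a ≢ tree × OnCycle G st P a e)) →
                  combo G st P λ′ e ≡ 0ℤ
  combo-outside λ′ {e} untouched =
    trans (∑ℤ≡sum (λ a → λ′ a ℤ.* χC G st P a e)) (sum-zero term≡0)
    where
    term≡0 : ∀ a → λ′ a ℤ.* χC G st P a e ≡ 0ℤ
    term≡0 a = trans (cong (λ′ a ℤ.*_) (χC-outside (λ a∉tree on → untouched (a , a∉tree , on))))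
                     (ℤP.*-zeroʳ (λ′ a))

  combo-cycleCoordinates : ∀ f g {e} → st e ≢ tree →
                           combo G st P (cycleCoordinates st f g) e ≡ g e ℤ.- f e
  combo-cycleCoordinates f g e∉tree =
    trans (combo-nontree (cycleCoordinates st f g) e∉tree) (orientation-involutive e∉tree _)

  cycleCostBound : (u : Fin (m G) → ℤ) (c : Fin (m G) → ℚ) → ℚ
  cycleCostBound u c =
    ∑ℚ (λ a → toℚ (u a) ℚ.* cycleCost G st P c a ⊔ toℚ (ℤ.- u a) ℚ.* cycleCost G st P c a)

  module _ {u : Fin (m G) → ℤ} {b : Fin (n G) → ℤ} where

    divergence-feasible : ∀ {f} → Feasible G u b f → ∀ i → divergence G f i ≡ b i
    divergence-feasible {f} f-feasible i =
      trans (sym (outflow-inflow≡divergence G u b f i)) (proj₁ f-feasible i)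

    cycleCoordinates-decompose : (∀ v (w : Walk G (TreeArcs G st) v v) → ¬ IsCycle w) →
                                 ∀ {f g} → Feasible G u b f → Feasible G u b g →
                                 ∀ e → g e ≡ f e ℤ.+ combo G st P (cycleCoordinates st f g) e
    cycleCoordinates-decompose acyclic {f} {g} f-feasible g-feasible e = begin
        g e
      ≡⟨ split (g e) (f e) (Λ e) ⟩
        residual e ℤ.+ (f e ℤ.+ Λ e)
      ≡⟨ cong (ℤ._+ (f e ℤ.+ Λ e)) (circulation-on-forest≡0 acyclic residual off-tree circulation e) ⟩
        0ℤ ℤ.+ (f e ℤ.+ Λ e)
      ≡⟨ ℤP.+-identityˡ (f e ℤ.+ Λ e) ⟩
        f e ℤ.+ Λ e ∎
      where
      Λ residual : Fin (m G) → ℤ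
      Λ = combo G st P (cycleCoordinates st f g)
      residual e = g e ℤ.- f e ℤ.- Λ e
      split : ∀ x y z → x ≡ (x ℤ.- y ℤ.- z) ℤ.+ (y ℤ.+ z)
      split = solve-∀
      off-tree : ∀ e → TreeArcs G st e ≡ false → residual e ≡ 0ℤ
      off-tree e e∉T =
        trans (cong (ℤ._-_ (g e ℤ.- f e)) (combo-cycleCoordinates f g (inT≡false⇒≢tree e∉T)))
              (ℤP.+-inverseʳ (g e ℤ.- f e))
      circulation : ∀ i → divergence G residual i ≡ 0ℤ
      circulation i = begin
          divergence G residual i
        ≡⟨ divergence-− G (λ e → g e ℤ.- f e) Λ i ⟩
          divergence G (λ e → g e ℤ.- f e) i ℤ.- divergence G Λ i
        ≡⟨ cong₂ ℤ._-_ (divergence-− G g f i) (divergence-combo (cycleCoordinates st f g) i) ⟩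
          divergence G g i ℤ.- divergence G f i ℤ.- 0ℤ
        ≡⟨ cong (ℤ._- 0ℤ) (cong₂ ℤ._-_ (divergence-feasible g-feasible i) (divergence-feasible f-feasible i)) ⟩
          b i ℤ.- b i ℤ.- 0ℤ
        ≡⟨ cancel (b i) ⟩
          0ℤ ∎
        where
        cancel : ∀ x → x ℤ.- x ℤ.- 0ℤ ≡ 0ℤ
        cancel = solve-∀

    feasible-from-cycles : ∀ {f g λ′} → Feasible G u b f →
      (∀ e → (∃[ a ] (st a ≢ tree × OnCycle G st P a e)) →
             (0ℤ ℤ.- f e ℤ.≤ combo G st P λ′ e) × (combo G st P λ′ e ℤ.≤ u e ℤ.- f e)) →
      (∀ e → g e ≡ f e ℤ.+ combo G st P λ′ e) → Feasible G u b g
    feasible-from-cycles {f} {g} {λ′} f-feasible on-cycles g≡ = conservation , capacity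
      where
      conservation : ∀ i → outflow G u b g i ℤ.- inflow G u b g i ≡ b i
      conservation i = begin
          outflow G u b g i ℤ.- inflow G u b g i
        ≡⟨ outflow-inflow≡divergence G u b g i ⟩
          divergence G g i
        ≡⟨ divergence-cong G g≡ i ⟩
          divergence G (λ e → f e ℤ.+ combo G st P λ′ e) i
        ≡⟨ divergence-+ G f (combo G st P λ′) i ⟩
          divergence G f i ℤ.+ divergence G (combo G st P λ′) i
        ≡⟨ cong₂ ℤ._+_ (divergence-feasible f-feasible i) (divergence-combo λ′ i) ⟩
          b i ℤ.+ 0ℤ
        ≡⟨ ℤP.+-identityʳ (b i) ⟩
          b i ∎
      onCycle? : ∀ a e → Dec (OnCycle G st P a e)
      onCycle? a e = (e ≟ a) ⊎-dec (DecMembership._∈?_ _≟_ e (arcs (P a)))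
      capacity : ∀ e → 0ℤ ℤ.≤ g e × g e ℤ.≤ u e
      capacity e with FinP.any? (λ a → ¬? (isTree? (st a)) ×-dec onCycle? a e)
      ... | yes touched =
        let lo , hi = on-cycles e touched
        in subst (λ x → 0ℤ ℤ.≤ x × x ℤ.≤ u e) (sym (g≡ e)) (interval-translate (f e) lo hi)
      ... | no untouched = subst (λ x → 0ℤ ℤ.≤ x × x ℤ.≤ u e) (sym g≡f) (proj₂ f-feasible e)
        where
        g≡f : g e ≡ f e
        g≡f = trans (g≡ e) (trans (cong (ℤ._+_ (f e)) (combo-outside λ′ untouched)) (ℤP.+-identityʳ (f e)))

    cycleCoordinates-bounded : ∀ {f g} → Feasible G u b f → Feasible G u b g → ∀ a →
                               ℤ.- u a ℤ.≤ cycleCoordinates st f g a × cycleCoordinates st f g a ℤ.≤ u a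
    cycleCoordinates-bounded (_ , f-capacity) (_ , g-capacity) a =
      let 0≤f , f≤u = f-capacity a
          0≤g , g≤u = g-capacity a
      in orientation-*-bounded (st a) (ℤP.≤-trans 0≤f f≤u) (difference-bounded 0≤g g≤u 0≤f f≤u)

    cycleCoordinates-MMCIFFeasible : (∀ v (w : Walk G (TreeArcs G st) v v) → ¬ IsCycle w) →
      ∀ {f g c ε} → Feasible G u b f → Feasible G u b g → cycleCostBound u c ℚ.≤ ε →
      MMCIFFeasible G st P u f c ε (cycleCoordinates st f g)
    cycleCoordinates-MMCIFFeasible acyclic {f} {g} {c} {ε} f-feasible g-feasible bound≤ε =
      vanishes-on-tree , capacity , budget
      where
      λ′ = cycleCoordinates st f g
      vanishes-on-tree : ∀ a → st a ≡ tree → λ′ a ≡ 0ℤ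
      vanishes-on-tree a a-tree = cong (λ s → orientation s ℤ.* (g a ℤ.- f a)) a-tree
      combo≡g-f : ∀ e → combo G st P λ′ e ≡ g e ℤ.- f e
      combo≡g-f e =
        trans (unshift (f e) _)
              (cong (ℤ._- f e) (sym (cycleCoordinates-decompose acyclic f-feasible g-feasible e)))
        where
        unshift : ∀ y z → z ≡ y ℤ.+ z ℤ.- y
        unshift = solve-∀
      capacity : ∀ e → (∃[ a ] (st a ≢ tree × OnCycle G st P a e)) →
                 (0ℤ ℤ.- f e ℤ.≤ combo G st P λ′ e) × (combo G st P λ′ e ℤ.≤ u e ℤ.- f e)
      capacity e _ = subst (λ x → 0ℤ ℤ.- f e ℤ.≤ x × x ℤ.≤ u e ℤ.- f e) (sym (combo≡g-f e))
                           (ℤP.+-monoˡ-≤ (ℤ.- f e) 0≤g , ℤP.+-monoˡ-≤ (ℤ.- f e) g≤u)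
        where
        0≤g = proj₁ (proj₂ g-feasible e)
        g≤u = proj₂ (proj₂ g-feasible e)
      budget : ∑ℚ (λ a → toℚ (λ′ a) ℚ.* cycleCost G st P c a) ℚ.≤ ε
      budget = ℚP.≤-trans (∑ℚ-mono-≤ term≤) bound≤ε
        where
        term≤ : ∀ a → toℚ (λ′ a) ℚ.* cycleCost G st P c a ℚ.≤
                      toℚ (u a) ℚ.* cycleCost G st P c a ⊔ toℚ (ℤ.- u a) ℚ.* cycleCost G st P c a
        term≤ a = let lo , hi = cycleCoordinates-bounded f-feasible g-feasible a
                  in *-bounded-by-endpoints (cycleCost G st P c a) (toℚ-mono-≤ lo) (toℚ-mono-≤ hi)

theorem4p11 :
    (G : Digraph) → Connected G →
    (u : Fin (Digraph.m G) → ℤ) (b : Fin (Digraph.n G) → ℤ)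
    (c¹ c² : Fin (Digraph.m G) → ℚ)
    (f : Fin (Digraph.m G) → ℤ) (st : Fin (Digraph.m G) → Status) (P : TreePaths G st) →
    IsTreeSolution G u b f st →
    (∀ a → st a ≢ tree → IsPath (P a)) →
    Optimal G u b c¹ f →
    ∃[ E ] ∀ (ε : ℚ) → E ℚ.≤ ε →
      ∀ (g : Fin (Digraph.m G) → ℤ) →
        Feasible G u b g ⇔
        (∃[ λ' ] (MMCIFFeasible G st P u f c² ε λ'
                  × (∀ e → g e ≡ f e ℤ.+ combo G st P λ' e)))
theorem4p11 G _ u b _ c² f st P (f-feasible , (_ , acyclic) , _) _ _ =
  cycleCostBound G st P u c² , λ ε bound≤ε g → mk⇔
    (λ g-feasible → cycleCoordinates st f g
                  , cycleCoordinates-MMCIFFeasible G st P acyclic {c = c²} f-feasible g-feasible bound≤ε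
                  , cycleCoordinates-decompose G st P acyclic f-feasible g-feasible)
    (λ { (λ′ , (_ , on-cycles , _) , g≡) →
           feasible-from-cycles G st P {λ′ = λ′} f-feasible on-cycles g≡ })
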